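{- There is a constant $c>0$ such that for every $n\ge 2$ and any two HC trees $T_1,T_2$ of order $n$, $T_1$ can be converted into $T_2$ by a sequence of interchange operations, and the minimum number of interchange operations needed, $\mathrm{idist}(T_1,T_2)$, satisfies $\mathrm{idist}(T_1,T_2)\le c\, n\log n$ (i.e., $\mathrm{idist}(T_1,T_2)=O(n\log n)$).
   Context: An HC tree of order $n$ is a full binary rooted tree with $n$ leaves, each labeled by a distinct element of $[n]$; children are unordered (trees are identified up to reordering children). Interchange on an edge $(x,y)$, where $x$ is a non-leaf node and $y$ its parent, $x$ has child subtrees $A,B$ and $y$ has other child subtree $C$: replace $T$ by the tree obtained by swapping the subtree $C$ with $B$, or by swapping $C$ with $A$. $\mathrm{idist}(T_1,T_2)$ is the minimum number of interchange operations converting $T_1$ into $T_2$. -}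

module Defs where

open import Data.Nat using (ℕ; zero; suc)
open import Data.Fin using (Fin)
open import Data.List using (List; []; _∷_; _++_)
open import Data.List.Relation.Binary.Permutation.Propositional using (_↭_)
open import Data.Fin.Base using () 
import Data.List as L
open import Data.Product using (Σ; _×_)

-- Raw (planar) full binary trees with leaves labelled by elements of Fin n
-- (Fin n plays the role of [n]).  Every node has exactly two children, so
-- every such tree is full.
data Tree (n : ℕ) : Set where
  leaf : Fin n → Tree n
  node : Tree n → Tree n → Tree n

leaves : ∀ {n} → Tree n → List (Fin n)
leaves (leaf i)   = i ∷ []
leaves (node l r) = leaves l ++ leaves r

IsHC : ∀ {n} → Tree n → Set
IsHC {n} T = leaves T ↭ L.allFin n

-- Trees are identified up to reordering children: the congruence generated
-- by swapping the two children of a node.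
data _≈_ {n : ℕ} : Tree n → Tree n → Set where
  ≈-refl  : ∀ {T} → T ≈ T
  ≈-sym   : ∀ {T U} → T ≈ U → U ≈ T
  ≈-trans : ∀ {T U V} → T ≈ U → U ≈ V → T ≈ V
  ≈-swap  : ∀ {A B} → node A B ≈ node B A
  ≈-node  : ∀ {A A′ B B′} → A ≈ A′ → B ≈ B′ → node A B ≈ node A′ B′

-- Interchange on a raw tree, on an edge (x , y) with x the (left) child of y,
-- x having children A , B and y having other child C:
--   swap C with B, or swap C with A; applied at any position in the tree.
-- (The case where x is the right child is covered by working up to ≈.)
data _⟶_ {n : ℕ} : Tree n → Tree n → Set where
  swapCB : ∀ {A B C} → node (node A B) C ⟶ node (node A C) B
  swapCA : ∀ {A B C} → node (node A B) C ⟶ node (node C B) A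
  inL    : ∀ {T T′ S} → T ⟶ T′ → node T S ⟶ node T′ S
  inR    : ∀ {T S S′} → S ⟶ S′ → node T S ⟶ node T S′

Interchange : ∀ {n} → Tree n → Tree n → Set
Interchange T U = Σ _ λ T′ → Σ _ λ U′ → T ≈ T′ × T′ ⟶ U′ × U′ ≈ U

data Converts {n : ℕ} : Tree n → Tree n → ℕ → Set where
  done : ∀ {T U} → T ≈ U → Converts T U zero
  step : ∀ {T V U k} → Interchange T V → Converts V U k → Converts T U (suc k)

{-# OPTIONS --safe #-}
-- Interchanges can rotate any tree onto a caterpillar ("comb") of its leaves using fewer
-- than n operations, one per internal node.  On combs they implement merge sort: cutting
-- a comb in two costs at most its length, and so does merging two sorted combs, because
-- each interchange moves the smaller of the two front leaves onto the output spine.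
-- Hence a comb of length L ≤ 2^d is sorted within 2dL interchanges.  Both trees reach the
-- same sorted comb, and interchanges are reversible.
module Submission where

open import Defs
open import Data.Nat using (ℕ; zero; suc; pred; _+_; _*_; _^_; _≤_; _<_; z≤n; s≤s)
open import Data.Nat.Properties
  using (≤-trans; ≤-reflexive; <⇒≤; n≤1+n; n<1+n; m≤m+n; m≤m*n; 1+n≰n; ≰⇒>; +-comm; +-suc;
         +-identityʳ; +-mono-≤; +-monoˡ-≤; +-monoʳ-≤; +-cancelˡ-≤; *-monoˡ-≤; *-monoʳ-≤;
         suc-pred; m^n≢0; module ≤-Reasoning)
open import Data.Nat.Logarithm using (⌊log₂_⌋; ⌊log₂⌋-mono-≤; ⌊log₂[2^n]⌋≡n)
open import Data.Nat.Tactic.RingSolver using (solve-∀)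
open import Data.Fin as Fin using (Fin)
open import Data.Fin.Properties using (≤-totalOrder; ≤-total) renaming (≤-trans to ≤ᶠ-trans)
open import Data.List using (List; []; _∷_; _++_; [_]; length; allFin)
open import Data.List.Properties using (length-++; length-tabulate)
import Data.List.Relation.Unary.All as All
open import Data.List.Relation.Unary.All.Properties using (++⁺)
open import Data.List.Relation.Unary.Linked using ([-]; _∷_)
open import Data.List.Relation.Unary.Linked.Properties using (Linked⇒All)
import Data.List.Relation.Unary.Sorted.TotalOrder as SortedOrder
open import Data.List.Relation.Unary.Sorted.TotalOrder.Properties using (↗↭↗⇒≋)
open import Data.List.Relation.Binary.Equality.Propositional using (≋⇒≡)
open import Data.List.Relation.Binary.Permutation.Propositional
  using (_↭_; ↭-refl; ↭-sym; ↭-trans; prep; ↭⇒↭ₛ)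
open import Data.List.Relation.Binary.Permutation.Propositional.Properties
  using (All-resp-↭; ↭-length; shift; ++-comm)
  renaming (++⁺ to ↭-++⁺)
open import Data.Product using (Σ; _×_; _,_; ∃₂)
open import Data.Sum using (inj₁; inj₂)
open import Relation.Binary.PropositionalEquality
  using (_≡_; refl; sym; trans; cong; cong₂; subst; module ≡-Reasoning)

private variable
  n a b : ℕ
  T U V A B C : Tree n
  x y : Fin n
  xs ys : List (Fin n)

⟶-sym : T ⟶ U → U ⟶ T
⟶-sym swapCB  = swapCB
⟶-sym swapCA  = swapCA
⟶-sym (inL r) = inL (⟶-sym r)
⟶-sym (inR r) = inR (⟶-sym r)

Interchange-sym : Interchange T U → Interchange U T
Interchange-sym (_ , _ , T≈ , r , ≈U) = _ , _ , ≈-sym ≈U , ⟶-sym r , ≈-sym T≈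

Interchange-node⁺ˡ : Interchange A B → Interchange (node A C) (node B C)
Interchange-node⁺ˡ (_ , _ , A≈ , r , ≈B) = _ , _ , ≈-node A≈ ≈-refl , inL r , ≈-node ≈B ≈-refl

Interchange-node⁺ʳ : Interchange B C → Interchange (node A B) (node A C)
Interchange-node⁺ʳ (_ , _ , B≈ , r , ≈C) = _ , _ , ≈-node ≈-refl B≈ , inR r , ≈-node ≈-refl ≈C

assocʳ : Interchange (node (node A B) C) (node A (node B C))
assocʳ = _ , _ , ≈-refl , swapCA , ≈-trans ≈-swap (≈-node ≈-refl ≈-swap)

exchange : Interchange (node A (node B C)) (node B (node A C))
exchange = _ , _ , ≈-swap , swapCA , ≈-swap

Converts-≈ˡ : T ≈ U → Converts U V a → Converts T V a
Converts-≈ˡ T≈U (done U≈V)                   = done (≈-trans T≈U U≈V)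
Converts-≈ˡ T≈U (step (_ , _ , U≈ , r , ≈) c) = step (_ , _ , ≈-trans T≈U U≈ , r , ≈) c

Converts-trans : Converts T U a → Converts U V b → Converts T V (a + b)
Converts-trans (done T≈U) c = Converts-≈ˡ T≈U c
Converts-trans (step i c) d = step i (Converts-trans c d)

Converts-sym : Converts T U a → Converts U T a
Converts-sym (done T≈U) = done (≈-sym T≈U)
Converts-sym {a = suc a} (step i c) =
  subst (Converts _ _) (+-comm a 1) (Converts-trans (Converts-sym c) (step (Interchange-sym i) (done ≈-refl)))

Converts-node⁺ˡ : Converts A B a → Converts (node A C) (node B C) a
Converts-node⁺ˡ (done A≈B) = done (≈-node A≈B ≈-refl)
Converts-node⁺ˡ (step i c) = step (Interchange-node⁺ˡ i) (Converts-node⁺ˡ c)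

Converts-node⁺ʳ : Converts B C a → Converts (node A B) (node A C) a
Converts-node⁺ʳ (done B≈C) = done (≈-node ≈-refl B≈C)
Converts-node⁺ʳ (step i c) = step (Interchange-node⁺ʳ i) (Converts-node⁺ʳ c)

ConvertsWithin : Tree n → Tree n → ℕ → Set
ConvertsWithin T U b = Σ ℕ λ k → Converts T U k × k ≤ b

≈⇒ConvertsWithin : T ≈ U → ConvertsWithin T U b
≈⇒ConvertsWithin T≈U = 0 , done T≈U , z≤n

infixr 5 _◅_ _◅◅_

_◅_ : Interchange T U → ConvertsWithin U V b → ConvertsWithin T V (suc b)
i ◅ (k , c , k≤b) = suc k , step i c , s≤s k≤b

_◅◅_ : ConvertsWithin T U a → ConvertsWithin U V b → ConvertsWithin T V (a + b)
(k , c , k≤a) ◅◅ (l , d , l≤b) = k + l , Converts-trans c d , +-mono-≤ k≤a l≤b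

ConvertsWithin-mono : a ≤ b → ConvertsWithin T U a → ConvertsWithin T U b
ConvertsWithin-mono a≤b (k , c , k≤a) = k , c , ≤-trans k≤a a≤b

ConvertsWithin-sym : ConvertsWithin T U b → ConvertsWithin U T b
ConvertsWithin-sym (k , c , k≤b) = k , Converts-sym c , k≤b

ConvertsWithin-node⁺ˡ : ConvertsWithin A B b → ConvertsWithin (node A C) (node B C) b
ConvertsWithin-node⁺ˡ (k , c , k≤b) = k , Converts-node⁺ˡ c , k≤b

ConvertsWithin-node⁺ʳ : ConvertsWithin B C b → ConvertsWithin (node A B) (node A C) b
ConvertsWithin-node⁺ʳ (k , c , k≤b) = k , Converts-node⁺ʳ c , k≤b

comb : Fin n → List (Fin n) → Tree n
comb x []       = leaf x
comb x (y ∷ ys) = node (leaf x) (comb y ys)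

spine : List (Fin n) → Tree n → Tree n
spine []       R = R
spine (x ∷ xs) R = node (leaf x) (spine xs R)

spine-++ : (xs ys : List (Fin n)) (R : Tree n) → spine (xs ++ ys) R ≡ spine xs (spine ys R)
spine-++ []       ys R = refl
spine-++ (x ∷ xs) ys R = cong (node (leaf x)) (spine-++ xs ys R)

spine-comb : (x : Fin n) (xs : List (Fin n)) (y : Fin n) (ys : List (Fin n)) →
             spine (x ∷ xs) (comb y ys) ≡ comb x (xs ++ y ∷ ys)
spine-comb x []        y ys = refl
spine-comb x (x′ ∷ xs) y ys = cong (node (leaf x)) (spine-comb x′ xs y ys)

size : Tree n → ℕ
size (leaf _)   = 0
size (node A B) = suc (size A + size B)

length-leaves : (T : Tree n) → length (leaves T) ≡ suc (size T)
length-leaves (leaf _)   = refl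
length-leaves (node A B) = begin
  length (leaves A ++ leaves B)           ≡⟨ length-++ (leaves A) ⟩
  length (leaves A) + length (leaves B)   ≡⟨ cong₂ _+_ (length-leaves A) (length-leaves B) ⟩
  suc (size A + suc (size B))             ≡⟨ cong suc (+-suc (size A) (size B)) ⟩
  suc (suc (size A + size B))             ∎
  where open ≡-Reasoning

leaves-∷ : (T : Tree n) → ∃₂ λ x xs → leaves T ≡ x ∷ xs
leaves-∷ (leaf x)   = x , [] , refl
leaves-∷ (node A B) with leaves-∷ A
... | x , xs , eq = x , xs ++ leaves B , cong (_++ leaves B) eq

flatten : (T R : Tree n) → ConvertsWithin (node T R) (spine (leaves T) R) (size T)
flatten (leaf _)   R = ≈⇒ConvertsWithin ≈-refl
flatten (node A B) R rewrite spine-++ (leaves A) (leaves B) R =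
  ConvertsWithin-mono (≤-reflexive (cong suc (+-comm (size B) (size A))))
    (assocʳ ◅ ConvertsWithin-node⁺ʳ (flatten B R) ◅◅ flatten A (spine (leaves B) R))

toComb : (T : Tree n) → ∃₂ λ x xs → leaves T ≡ x ∷ xs × ConvertsWithin T (comb x xs) (size T)
toComb (leaf x)   = x , [] , refl , ≈⇒ConvertsWithin ≈-refl
toComb (node A B) with toComb B | leaves-∷ A
... | y , ys , eqB , B⇝ | x , xs , eqA =
  x , xs ++ y ∷ ys , cong₂ _++_ eqA eqB ,
  ConvertsWithin-mono (≤-trans (≤-reflexive (+-comm (size B) (size A))) (n≤1+n _))
    (ConvertsWithin-node⁺ʳ B⇝ ◅◅ flattenA)
  where
  flattenA : ConvertsWithin (node A (comb y ys)) (comb x (xs ++ y ∷ ys)) (size A)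
  flattenA = subst (λ R → ConvertsWithin _ R (size A))
    (trans (cong (λ l → spine l (comb y ys)) eqA) (spine-comb x xs y ys))
    (flatten A (comb y ys))

joinCombs : (x : Fin n) (xs : List (Fin n)) (y : Fin n) (ys : List (Fin n)) →
            ConvertsWithin (node (comb x xs) (comb y ys)) (comb x (xs ++ y ∷ ys)) (length xs)
joinCombs x []        y ys = ≈⇒ConvertsWithin ≈-refl
joinCombs x (x′ ∷ xs) y ys = assocʳ ◅ ConvertsWithin-node⁺ʳ (joinCombs x′ xs y ys)

Sorted : List (Fin n) → Set
Sorted {n} = SortedOrder.Sorted (≤-totalOrder n)

Sorted-↭⇒≡ : Sorted xs → Sorted ys → xs ↭ ys → xs ≡ ys
Sorted-↭⇒≡ {n} xs↗ ys↗ xs↭ys = ≋⇒≡ (↗↭↗⇒≋ (≤-totalOrder n) xs↗ ys↗ (↭⇒↭ₛ xs↭ys))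

record SortedCombWithin (T : Tree n) (xs : List (Fin n)) (b : ℕ) : Set where
  constructor sortedComb
  field
    {first}     : Fin n
    {rest}      : List (Fin n)
    sorted      : Sorted (first ∷ rest)
    permutation : first ∷ rest ↭ xs
    conversion  : ConvertsWithin T (comb first rest) b

SortedCombWithin-mono : a ≤ b → SortedCombWithin T xs a → SortedCombWithin T xs b
SortedCombWithin-mono a≤b (sortedComb s p c) = sortedComb s p (ConvertsWithin-mono a≤b c)

SortedCombWithin-resp-↭ : xs ↭ ys → SortedCombWithin T xs b → SortedCombWithin T ys b
SortedCombWithin-resp-↭ xs↭ys (sortedComb s p c) = sortedComb s (↭-trans p xs↭ys) c

infixr 5 _◅◅ˢ_

_◅◅ˢ_ : ConvertsWithin T U a → SortedCombWithin U xs b → SortedCombWithin T xs (a + b)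
T⇝U ◅◅ˢ sortedComb s p c = sortedComb s p (T⇝U ◅◅ c)

SortedCombWithin-join : SortedCombWithin T xs a → SortedCombWithin U xs b → ConvertsWithin T U (a + b)
SortedCombWithin-join (sortedComb s p c) (sortedComb s′ p′ c′)
  with Sorted-↭⇒≡ s s′ (↭-trans p (↭-sym p′))
... | refl = c ◅◅ ConvertsWithin-sym c′

≤-merge-head : ∀ {x x′ y w : Fin n} {xs ys ws} → x Fin.≤ x′ → x Fin.≤ y →
               Sorted (x′ ∷ xs) → Sorted (y ∷ ys) → w ∷ ws ↭ x′ ∷ xs ++ y ∷ ys → x Fin.≤ w
≤-merge-head x≤x′ x≤y x′∷xs↗ y∷ys↗ w∷ws↭ = All.head (All-resp-↭ (↭-sym w∷ws↭)
  (++⁺ (Linked⇒All ≤ᶠ-trans x≤x′ x′∷xs↗) (Linked⇒All ≤ᶠ-trans x≤y y∷ys↗)))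

mergeCombs : Sorted (x ∷ xs) → Sorted (y ∷ ys) →
             SortedCombWithin (node (comb x xs) (comb y ys)) (x ∷ xs ++ y ∷ ys) (length xs + length ys)
mergeCombs {x = x} {y = y} _ _ with ≤-total x y
mergeCombs [-] y∷ys↗ | inj₁ x≤y =
  sortedComb (x≤y ∷ y∷ys↗) ↭-refl (≈⇒ConvertsWithin ≈-refl)
mergeCombs (x≤x′ ∷ xs↗) y∷ys↗ | inj₁ x≤y with mergeCombs xs↗ y∷ys↗
... | sortedComb s p c =
  sortedComb (≤-merge-head x≤x′ x≤y xs↗ y∷ys↗ p ∷ s) (prep _ p) (assocʳ ◅ ConvertsWithin-node⁺ʳ c)
mergeCombs {x = x} {xs} {y} x∷xs↗ [-] | inj₂ y≤x =
  sortedComb (y≤x ∷ x∷xs↗) (↭-sym (++-comm (x ∷ xs) [ y ])) (≈⇒ConvertsWithin ≈-swap)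
mergeCombs {x = x} {xs} {y} {y′ ∷ ys} x∷xs↗ (y≤y′ ∷ ys↗) | inj₂ y≤x with mergeCombs x∷xs↗ ys↗
... | sortedComb s p c =
  sortedComb (≤-merge-head y≤x y≤y′ x∷xs↗ ys↗ p ∷ s)
    (↭-trans (prep y p) (↭-sym (shift y (x ∷ xs) (y′ ∷ ys))))
    (ConvertsWithin-mono (≤-reflexive (sym (+-suc (length xs) (length ys))))
      (exchange ◅ ConvertsWithin-node⁺ʳ c))

SortedCombWithin-node : SortedCombWithin A xs a → SortedCombWithin B ys b →
                        SortedCombWithin (node A B) (xs ++ ys) (a + (b + length (xs ++ ys)))
SortedCombWithin-node {xs = xs} {ys = ys} (sortedComb {w} {ws} sA pA cA) (sortedComb {w′} {ws′} sB pB cB)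
  with mergeCombs sA sB
... | sortedComb s p c =
  sortedComb s (↭-trans p (↭-++⁺ pA pB))
    (ConvertsWithin-node⁺ˡ cA ◅◅ ConvertsWithin-node⁺ʳ cB ◅◅ ConvertsWithin-mono mergeCost c)
  where
  open ≤-Reasoning
  mergeCost : length ws + length ws′ ≤ length (xs ++ ys)
  mergeCost = begin
    length ws + length ws′          ≤⟨ +-monoʳ-≤ (length ws) (n≤1+n _) ⟩
    length ws + length (w′ ∷ ws′)   ≡⟨ length-++ ws ⟨
    length (ws ++ w′ ∷ ws′)         <⟨ n<1+n _ ⟩
    length (w ∷ ws ++ w′ ∷ ws′)     ≡⟨ ↭-length (↭-++⁺ pA pB) ⟩
    length (xs ++ ys)               ∎

data SplitAt {A : Set} (m : ℕ) : List A → Set where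
  short : {xs : List A} → length xs ≤ m → SplitAt m xs
  split : (ps : List A) (z : A) (zs : List A) → length ps ≡ m → SplitAt m (ps ++ z ∷ zs)

splitAt-view : {A : Set} (m : ℕ) (xs : List A) → SplitAt m xs
splitAt-view zero    []       = short z≤n
splitAt-view zero    (z ∷ zs) = split [] z zs refl
splitAt-view (suc m) []       = short z≤n
splitAt-view (suc m) (x ∷ xs) with splitAt-view m xs
... | short |xs|≤m        = short (s≤s |xs|≤m)
... | split ps z zs refl = split (x ∷ ps) z zs refl

mergeSortCost : ∀ d p la lb L → p ≤ la → L ≡ la + lb →
                p + (d * (2 * la) + (d * (2 * lb) + L)) ≤ suc d * (2 * L)
mergeSortCost d p la lb L p≤la refl =
  ≤-trans (+-monoˡ-≤ _ (≤-trans p≤la (m≤m+n la lb))) (≤-reflexive (regroup d la lb))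
  where
  regroup : ∀ d la lb → (la + lb) + (d * (2 * la) + (d * (2 * lb) + (la + lb))) ≡ suc d * (2 * (la + lb))
  regroup = solve-∀

suc-pred-2^ : ∀ d → suc (pred (2 ^ d)) ≡ 2 ^ d
suc-pred-2^ d = suc-pred (2 ^ d) {{m^n≢0 2 d}}

sortComb : ∀ d (x : Fin n) xs → length (x ∷ xs) ≤ 2 ^ d →
           SortedCombWithin (comb x xs) (x ∷ xs) (d * (2 * length (x ∷ xs)))
sortComb zero    x []      _        = sortedComb [-] ↭-refl (≈⇒ConvertsWithin ≈-refl)
sortComb zero    x (_ ∷ _) (s≤s ())
sortComb (suc d) x xs      |x∷xs|≤ with splitAt-view (pred (2 ^ d)) xs
... | short |xs|≤ =
  SortedCombWithin-mono (*-monoˡ-≤ _ (n≤1+n d))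
    (sortComb d x xs (subst (suc (length xs) ≤_) (suc-pred-2^ d) (s≤s |xs|≤)))
... | split ps z zs |ps|≡ =
  SortedCombWithin-mono
    (mergeSortCost d (length ps) (length (x ∷ ps)) (length (z ∷ zs)) _ (n≤1+n _) (cong suc (length-++ ps)))
    (ConvertsWithin-sym (joinCombs x ps z zs)
      ◅◅ˢ SortedCombWithin-node (sortComb d x ps (≤-reflexive |x∷ps|≡2^d))
                               (sortComb d z zs |z∷zs|≤2^d))
  where
  |x∷ps|≡2^d : length (x ∷ ps) ≡ 2 ^ d
  |x∷ps|≡2^d = trans (cong suc |ps|≡) (suc-pred-2^ d)
  |z∷zs|≤2^d : length (z ∷ zs) ≤ 2 ^ d
  |z∷zs|≤2^d = +-cancelˡ-≤ (2 ^ d) _ _ (begin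
    2 ^ d + length (z ∷ zs)                ≡⟨ cong (_+ length (z ∷ zs)) |x∷ps|≡2^d ⟨
    length (x ∷ ps) + length (z ∷ zs)      ≡⟨ length-++ (x ∷ ps) ⟨
    length (x ∷ ps ++ z ∷ zs)              ≤⟨ |x∷xs|≤ ⟩
    2 ^ d + (2 ^ d + 0)                    ≡⟨ cong (2 ^ d +_) (+-identityʳ (2 ^ d)) ⟩
    2 ^ d + 2 ^ d                          ∎)
    where open ≤-Reasoning

sortHC : ∀ d (T : Tree n) → IsHC T → n ≤ 2 ^ d → SortedCombWithin T (allFin n) (n + d * (2 * n))
sortHC {n} d T hc n≤2^d with toComb T
... | x , xs , leaves≡ , T⇝comb =
  ConvertsWithin-mono size≤n T⇝comb
    ◅◅ˢ SortedCombWithin-resp-↭ (subst (_↭ allFin n) leaves≡ hc)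
          (subst (λ L → SortedCombWithin (comb x xs) (x ∷ xs) (d * (2 * L))) |x∷xs|≡n
            (sortComb d x xs (subst (_≤ 2 ^ d) (sym |x∷xs|≡n) n≤2^d)))
  where
  |leaves|≡n : length (leaves T) ≡ n
  |leaves|≡n = trans (↭-length hc) (length-tabulate (λ i → i))
  |x∷xs|≡n : length (x ∷ xs) ≡ n
  |x∷xs|≡n = trans (cong length (sym leaves≡)) |leaves|≡n
  size≤n : size T ≤ n
  size≤n = ≤-trans (n≤1+n (size T)) (≤-reflexive (trans (sym (length-leaves T)) |leaves|≡n))

n<2^[1+⌊log₂n⌋] : ∀ n → n < 2 ^ suc ⌊log₂ n ⌋
n<2^[1+⌊log₂n⌋] n = ≰⇒> λ 2^[1+⌊log₂n⌋]≤n → 1+n≰n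
  (subst (_≤ ⌊log₂ n ⌋) (⌊log₂[2^n]⌋≡n (suc ⌊log₂ n ⌋)) (⌊log₂⌋-mono-≤ 2^[1+⌊log₂n⌋]≤n))

finalCost : ∀ n L → 1 ≤ L → (n + suc L * (2 * n)) + (n + suc L * (2 * n)) ≤ 10 * (n * L)
finalCost n L@(suc _) _ = begin
  (n + suc L * (2 * n)) + (n + suc L * (2 * n))   ≡⟨ expand n L ⟩
  6 * n + 4 * (n * L)                             ≤⟨ +-monoˡ-≤ _ (*-monoʳ-≤ 6 (m≤m*n n L)) ⟩
  6 * (n * L) + 4 * (n * L)                       ≡⟨ collect (n * L) ⟩
  10 * (n * L)                                    ∎
  where
  open ≤-Reasoning
  expand : ∀ n L → (n + (1 + L) * (2 * n)) + (n + (1 + L) * (2 * n)) ≡ 6 * n + 4 * (n * L)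
  expand = solve-∀
  collect : ∀ m → 6 * m + 4 * m ≡ 10 * m
  collect = solve-∀

mainTheorem4 : Σ ℕ λ c → 0 < c ×
    ((n : ℕ) → 2 ≤ n → (T₁ T₂ : Tree n) → IsHC T₁ → IsHC T₂ →
      Σ ℕ λ k → Converts T₁ T₂ k × k ≤ c * (n * ⌊log₂ n ⌋))
mainTheorem4 = 10 , s≤s z≤n , λ n 2≤n T₁ T₂ hc₁ hc₂ →
  let n≤2^D = <⇒≤ (n<2^[1+⌊log₂n⌋] n) in
  ConvertsWithin-mono (finalCost n ⌊log₂ n ⌋ (⌊log₂⌋-mono-≤ 2≤n))
    (SortedCombWithin-join (sortHC (suc ⌊log₂ n ⌋) T₁ hc₁ n≤2^D) (sortHC (suc ⌊log₂ n ⌋) T₂ hc₂ n≤2^D))
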